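{- There exists a function $g:\mathbb{N}\to\mathbb{N}$ which is not monotone and which is $\langle\mathbb{N};+\rangle$-congruence preserving.
   Context: A congruence on $\langle\mathbb{N};+\rangle$ is an equivalence relation $\sim$ on $\mathbb{N}$ such that $x\sim y$ and $x'\sim y'$ imply $x+x'\sim y+y'$. A function $g:\mathbb{N}\to\mathbb{N}$ is $\langle\mathbb{N};+\rangle$-congruence preserving if for every such congruence $\sim$, $x\sim y$ implies $g(x)\sim g(y)$. Monotone means non-decreasing or non-increasing. -}

module Defs where

open import Data.Nat using (ℕ; _+_; _≤_)
open import Data.Product using (_×_)
open import Relation.Nullary using (¬_)
open import Relation.Binary.Core using (Rel)
open import Relation.Binary.Structures using (IsEquivalence)
open import Level using (0ℓ)

record IsCongruence (_∼_ : Rel ℕ 0ℓ) : Set where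
  field
    isEquivalence : IsEquivalence _∼_
    +-compat : ∀ {x y x′ y′} → x ∼ y → x′ ∼ y′ → (x + x′) ∼ (y + y′)

CongruencePreserving : (ℕ → ℕ) → Set₁
CongruencePreserving g =
  (_∼_ : Rel ℕ 0ℓ) → IsCongruence _∼_ → ∀ {x y} → x ∼ y → g x ∼ g y

NonDecreasing : (ℕ → ℕ) → Set
NonDecreasing g = ∀ {x y} → x ≤ y → g x ≤ g y

NonIncreasing : (ℕ → ℕ) → Set
NonIncreasing g = ∀ {x y} → x ≤ y → g y ≤ g x

data Monotone (g : ℕ → ℕ) : Set where
  nondec : NonDecreasing g → Monotone g
  noninc : NonIncreasing g → Monotone g

-- If a ∼ a + d in a congruence on ⟨ℕ;+⟩, adding u − a to both sides gives u ∼ u + d for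
-- every u ≥ a, hence any two numbers ≥ a that agree modulo d are related. So a function
-- g with g x ≥ x and d ∣ g (x + d) − g x for all x, d preserves every congruence; the
-- polynomial x² − 3x + 4 = x + (x − 2)² is such a function, and it is not monotone since
-- it takes the values 4, 2, 2, 4 at 0, 1, 2, 3.
module Submission where

open import Defs
open import Data.List using (_∷_; [])
open import Data.Nat using (ℕ; zero; suc; _+_; _*_; _≤_; z≤n; s≤s)
open import Data.Nat.Properties
  using (≤-total; ≤-trans; m≤n⇒∃[o]m+o≡n; m≤m+n; +-identityʳ; +-cancelʳ-≡)
open import Data.Nat.Tactic.RingSolver using (solve; solve-∀)
open import Data.Product using (Σ; _×_; _,_; ∃₂)
open import Data.Sum using (inj₁; inj₂)
open import Level using (0ℓ)
open import Relation.Binary.Core using (Rel)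
open import Relation.Binary.PropositionalEquality using (_≡_; refl; sym; cong; subst; module ≡-Reasoning)
open import Relation.Binary.Structures using (IsEquivalence)
open import Relation.Nullary using (¬_)

Inflationary : (ℕ → ℕ) → Set
Inflationary g = ∀ x → x ≤ g x

-- u ≡ v (mod d), stated without subtraction.
CongruentMod : ℕ → ℕ → ℕ → Set
CongruentMod d u v = ∃₂ λ k l → u + k * d ≡ v + l * d

ShiftInvariantMod : (ℕ → ℕ) → Set
ShiftInvariantMod g = ∀ x d → CongruentMod d (g x) (g (x + d))

module _ {_∼_ : Rel ℕ 0ℓ} (isCongruence : IsCongruence _∼_) where
  open IsCongruence isCongruence
  open IsEquivalence isEquivalence renaming (refl to ∼-refl; sym to ∼-sym; trans to ∼-trans)

  ∼-step-above : ∀ {a d u} → a ∼ (a + d) → a ≤ u → u ∼ (u + d)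
  ∼-step-above {a} {d} a∼a+d a≤u with e , refl ← m≤n⇒∃[o]m+o≡n a≤u =
    subst ((a + e) ∼_) (rearrange a d e) (+-compat a∼a+d (∼-refl {e}))
    where
    rearrange : ∀ a d e → a + d + e ≡ a + e + d
    rearrange = solve-∀

  ∼-steps-above : ∀ {a d u} → a ∼ (a + d) → a ≤ u → ∀ k → u ∼ (u + k * d)
  ∼-steps-above {u = u} a∼a+d a≤u zero = subst (u ∼_) (sym (+-identityʳ u)) ∼-refl
  ∼-steps-above {d = d} {u} a∼a+d a≤u (suc k) =
    ∼-trans (∼-steps-above a∼a+d a≤u k)
      (subst ((u + k * d) ∼_) (rearrange u k d)
        (∼-step-above a∼a+d (≤-trans a≤u (m≤m+n u (k * d)))))
    where
    rearrange : ∀ u k d → u + k * d + d ≡ u + suc k * d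
    rearrange = solve-∀

  ∼-mod-above : ∀ {a d u v} → a ∼ (a + d) → a ≤ u → a ≤ v → CongruentMod d u v → u ∼ v
  ∼-mod-above {v = v} a∼a+d a≤u a≤v (k , l , u+kd≡v+ld) =
    ∼-trans (∼-steps-above a∼a+d a≤u k)
      (subst (_∼ v) (sym u+kd≡v+ld) (∼-sym (∼-steps-above a∼a+d a≤v l)))

  module _ {g : ℕ → ℕ} (inflationary : Inflationary g) (shiftInvariant : ShiftInvariantMod g) where

    ∼-preserved-≤ : ∀ {x y} → x ≤ y → x ∼ y → g x ∼ g y
    ∼-preserved-≤ {x} x≤y x∼y with d , refl ← m≤n⇒∃[o]m+o≡n x≤y =
      ∼-mod-above x∼y (inflationary x) (≤-trans (m≤m+n x d) (inflationary (x + d))) (shiftInvariant x d)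

    ∼-preserved : ∀ {x y} → x ∼ y → g x ∼ g y
    ∼-preserved {x} {y} x∼y with ≤-total x y
    ... | inj₁ x≤y = ∼-preserved-≤ x≤y x∼y
    ... | inj₂ y≤x = ∼-sym (∼-preserved-≤ y≤x (∼-sym x∼y))

inflationary∧shiftInvariantMod⇒congruencePreserving :
  ∀ {g} → Inflationary g → ShiftInvariantMod g → CongruencePreserving g
inflationary∧shiftInvariantMod⇒congruencePreserving inflationary shiftInvariant _ isCongruence =
  ∼-preserved isCongruence inflationary shiftInvariant

x²−3x+4-shift : ∀ x d {y z} → y + 3 * x ≡ x * x + 4 → z + 3 * (x + d) ≡ (x + d) * (x + d) + 4 →
                CongruentMod d y z
x²−3x+4-shift x d {y} {z} y≡ z≡ = 2 * x + d , 3 , +-cancelʳ-≡ (3 * (x + d)) _ _ (begin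
  y + (2 * x + d) * d + 3 * (x + d)      ≡⟨ solve (y ∷ x ∷ d ∷ []) ⟩
  (y + 3 * x) + (2 * x + d) * d + 3 * d  ≡⟨ cong (λ t → t + (2 * x + d) * d + 3 * d) y≡ ⟩
  (x * x + 4) + (2 * x + d) * d + 3 * d  ≡⟨ solve (x ∷ d ∷ []) ⟩
  ((x + d) * (x + d) + 4) + 3 * d        ≡⟨ cong (_+ 3 * d) z≡ ⟨
  (z + 3 * (x + d)) + 3 * d              ≡⟨ solve (z ∷ x ∷ d ∷ []) ⟩
  z + 3 * d + 3 * (x + d)                ∎)
  where open ≡-Reasoning

-- g x = x + (x − 2)² = x² − 3x + 4
g : ℕ → ℕ
g 0 = 4
g 1 = 2
g (suc (suc n)) = suc (suc n) + n * n

g-closedForm : ∀ x → g x + 3 * x ≡ x * x + 4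
g-closedForm 0 = refl
g-closedForm 1 = refl
g-closedForm (suc (suc n)) = polynomial n
  where
  polynomial : ∀ n → suc (suc n) + n * n + 3 * suc (suc n) ≡ suc (suc n) * suc (suc n) + 4
  polynomial = solve-∀

g-inflationary : Inflationary g
g-inflationary 0 = z≤n
g-inflationary 1 = s≤s z≤n
g-inflationary (suc (suc n)) = m≤m+n (suc (suc n)) (n * n)

g-shiftInvariantMod : ShiftInvariantMod g
g-shiftInvariantMod x d = x²−3x+4-shift x d (g-closedForm x) (g-closedForm (x + d))

g-nonMonotone : ¬ Monotone g
g-nonMonotone (nondec g↑) with g↑ {0} {1} z≤n
... | s≤s (s≤s ())
g-nonMonotone (noninc g↓) with g↓ {2} {3} (s≤s (s≤s z≤n))
... | s≤s (s≤s ())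

proposition3p16 : Σ (ℕ → ℕ) (λ g → ¬ Monotone g × CongruencePreserving g)
proposition3p16 =
  g , g-nonMonotone , inflationary∧shiftInvariantMod⇒congruencePreserving g-inflationary g-shiftInvariantMod
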